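{- For every integer $k\geq 2$: (a) there exists a finite sequence of integers $X$ such that $MHS_{k}(X)<MHS_{k-1}(X)<\ldots <MHS_{1}(X)$; (b) $\sup_{X}\,[MHS_{k-1}(X)-MHS_{k}(X)]=\infty$, the supremum being over all finite sequences of integers $X$.
   Context: A $k$-ary tree is a finite set of words over $\{1,\ldots,k\}$ closed under prefixes and under replacing the last letter by a smaller letter. A finite sequence $X=(X_{0},\ldots, X_{n-1})$ is $k$-heapable if there is a $k$-ary tree whose nodes are labeled bijectively by $X_0,\dots,X_{n-1}$ such that for every non-root node labeled $X_{i}$ with parent labeled $X_{j}$, $X_{j}\leq X_{i}$ and $j<i$. $MHS_{k}(X)$ is the smallest number of (not necessarily contiguous) $k$-heapable subsequences into which $X$ can be partitioned. -}

module Defs where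

open import Data.Nat using (ℕ; zero; suc; _<_; _≤_)
open import Data.Fin using (Fin; toℕ; _≟_)
open import Data.Fin.Properties using ()
open import Data.Integer using (ℤ) renaming (_≤_ to _≤ℤ_)
open import Data.List using (List; []; _∷_; _++_; length; lookup; map; filter; allFin)
open import Data.Product using (Σ; ∃; _×_; _,_)
open import Relation.Binary.PropositionalEquality using (_≡_; _≢_)
open import Function.Definitions using (Injective)

-- Words over the alphabet {1,…,k} are lists of letters Fin k
-- (letter i+1 is represented by the Fin element i; order is preserved).
Word : ℕ → Set
Word k = List (Fin k)

-- A finite set of words, given as the (injective) enumeration
-- T : Fin n → Word k, is a k-ary tree iff it is closed under prefixes and
-- under replacing the last letter by a smaller letter.
InImage : ∀ {k n} → (Fin n → Word k) → Word k → Set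
InImage {n = n} T w = ∃ λ (i : Fin n) → T i ≡ w

IsKaryTree : (k n : ℕ) → (Fin n → Word k) → Set
IsKaryTree k n T =
  Injective _≡_ _≡_ T
  × (∀ (w u : Word k) → InImage T (w ++ u) → InImage T w)
  × (∀ (w : Word k) (a b : Fin k) → toℕ b < toℕ a →
       InImage T (w ++ (a ∷ [])) → InImage T (w ++ (b ∷ [])))

KHeapable : ℕ → List ℤ → Set
KHeapable k X =
  Σ (Fin (length X) → Word k) λ T →
    IsKaryTree k (length X) T
    × (∀ (i j : Fin (length X)) (a : Fin k) → T i ≡ T j ++ (a ∷ []) →
         (toℕ j < toℕ i) × (lookup X j ≤ℤ lookup X i))

part : ∀ {m} (X : List ℤ) → (Fin (length X) → Fin m) → Fin m → List ℤ
part X c r = map (lookup X) (filter (λ i → c i ≟ r) (allFin (length X)))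

-- X can be partitioned into (at most) m k-heapable subsequences
-- (empty parts are allowed; they are trivially k-heapable).
PartitionableInto : ℕ → List ℤ → ℕ → Set
PartitionableInto k X m =
  Σ (Fin (length X) → Fin m) λ c → ∀ (r : Fin m) → KHeapable k (part X c r)

-- IsMHS k X m  :⇔  m = MHS_k(X), the least such number.
IsMHS : ℕ → List ℤ → ℕ → Set
IsMHS k X m = PartitionableInto k X m × (∀ m′ → PartitionableInto k X m′ → m ≤ m′)

module Submission where

-- Fix k and N and let X consist of N blocks of k+1 entries,
-- block t being  b, b+k-1, b+k-2, …, b+1, b  with b = -(t(k+1)+k), every
-- block lying strictly below the previous one.  The only pairs i < i' with
-- X_i ≤ X_i' start at the first entry (the "base") of a block, so in any
-- heap every parent is a base, and there are only N bases.  We show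
-- MHS_j(X) = N(k+1-j) for every j ≤ k; for k ≥ 2 both parts of the theorem
-- follow by taking N = 1, and by comparing j = k-1 with j = k.

open import Defs
open import Data.Nat using (ℕ; zero; suc; _<_; _≤_; z≤n; s≤s; _+_; _*_; _∸_; _⊓_; _≤?_)
open import Data.Nat.Properties
  using (≤-refl; ≤-reflexive; <⇒≤; <-trans; <-≤-trans; n≮0; ≰⇒>; <⇒≱; <-irrefl; m≤m+n;
         +-identityʳ; +-monoʳ-≤; +-cancelʳ-≤; *-distribˡ-+; *-suc; *-monoʳ-<; ∸-monoˡ-≤; ∸-monoʳ-<; m∸n≤m;
         m≤n⇒m≤1+n; m≤n⇒m∸n≡0; m<n⇒0<n∸m; m∸n+n≡m; m+n∸n≡m; +-∸-assoc; m⊓n≤m;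
         m⊓n+n∸m≡n; 0∸n≡0; ≮⇒≥; +-monoʳ-<; module ≤-Reasoning)
open import Data.Nat.Base using (s≤s⁻¹)
open import Data.Integer using (ℤ; +_; -_; +≤+) renaming (_≤_ to _≤ℤ_)
open import Data.Integer.Properties using (neg-mono-≤; neg-cancel-≤; drop‿+≤+)
open import Data.Fin
  using (Fin; zero; suc; toℕ; fromℕ<; inject≤; cast; join; splitAt; combine; remQuot; _≟_)
open import Data.Fin.Properties
  using (toℕ-injective; toℕ<n; toℕ-fromℕ<; toℕ-inject≤; inject≤-injective; toℕ-cast;
         toℕ-combine; combine-remQuot; remQuot-combine; combine-injectiveˡ; combine-injectiveʳ;
         splitAt-↑ˡ; splitAt-↑ʳ; injective⇒≤; <-cmp)
open import Data.List
  using (List; []; _∷_; _++_; _∷ʳ_; length; lookup; map; filter; tabulate; allFin; initLast; _∷ʳ′_)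
open import Data.List.Properties using (length-tabulate; lookup-tabulate; ∷-injectiveˡ)
open import Data.List.Membership.Propositional using (_∈_)
open import Data.List.Membership.Propositional.Properties using (∈-allFin)
open import Data.List.Relation.Unary.All as All using ()
open import Data.List.Relation.Unary.Any using (here; there)
open import Data.List.Relation.Unary.AllPairs using (AllPairs; _∷_)
open import Data.List.Relation.Unary.AllPairs.Properties using (tabulate⁺-<)
open import Data.Product using (∃; ∃₂; _×_; _,_; proj₁; proj₂; uncurry)
open import Data.Sum as Sum using (_⊎_; inj₁; inj₂)
open import Data.Empty using (⊥-elim)
open import Level using (0ℓ)
open import Relation.Nullary using (yes; no)
open import Relation.Unary using (Pred; Decidable)
open import Relation.Binary.Definitions using (tri<; tri≈; tri>)
open import Relation.Binary.PropositionalEquality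
  using (_≡_; refl; sym; trans; cong; cong₂; subst; subst₂; module ≡-Reasoning)
open import Function using (_∘_; id)
open import Function.Definitions using (Injective)

_≺_ : ∀ {n} → Fin n → Fin n → Set
i ≺ i′ = toℕ i < toℕ i′

module Selection {A : Set} {n : ℕ} {P : Pred (Fin n) 0ℓ} (P? : Decidable P) (f : Fin n → A) where

  selection : List (Fin n) → List A
  selection ys = map f (filter P? ys)

  source : ∀ ys → Fin (length (selection ys)) → Fin n
  source (y ∷ ys) q with P? y
  source (y ∷ ys) zero    | yes _ = y
  source (y ∷ ys) (suc q) | yes _ = source ys q
  ... | no _ = source ys q

  source-sat : ∀ ys q → P (source ys q)
  source-sat (y ∷ ys) q with P? y
  source-sat (y ∷ ys) zero    | yes py = py
  source-sat (y ∷ ys) (suc q) | yes _  = source-sat ys q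
  ... | no _ = source-sat ys q

  source-lookup : ∀ ys q → lookup (selection ys) q ≡ f (source ys q)
  source-lookup (y ∷ ys) q with P? y
  source-lookup (y ∷ ys) zero    | yes _ = refl
  source-lookup (y ∷ ys) (suc q) | yes _ = source-lookup ys q
  ... | no _ = source-lookup ys q

  source-∈ : ∀ ys q → source ys q ∈ ys
  source-∈ (y ∷ ys) q with P? y
  source-∈ (y ∷ ys) zero    | yes _ = here refl
  source-∈ (y ∷ ys) (suc q) | yes _ = there (source-∈ ys q)
  ... | no _ = there (source-∈ ys q)

  source-mono : ∀ ys → AllPairs _≺_ ys → ∀ q q′ → q ≺ q′ → source ys q ≺ source ys q′
  source-mono (y ∷ ys) (y≺ys ∷ sorted) q q′ q≺q′ with P? y
  source-mono (y ∷ ys) (y≺ys ∷ sorted) zero (suc q′) _ | yes _ =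
    All.lookup y≺ys (source-∈ ys q′)
  source-mono (y ∷ ys) (y≺ys ∷ sorted) (suc q) (suc q′) (s≤s q≺q′) | yes _ =
    source-mono ys sorted q q′ q≺q′
  ... | no _ = source-mono ys sorted q q′ q≺q′

  source-onto : ∀ ys {i} → i ∈ ys → P i → ∃ λ q → source ys q ≡ i
  source-onto (y ∷ ys) {i} i∈ pi with P? y
  source-onto (y ∷ ys) (here refl) pi | yes _ = zero , refl
  source-onto (y ∷ ys) (there i∈)  pi | yes _ with source-onto ys i∈ pi
  ... | q , eq = suc q , eq
  source-onto (y ∷ ys) (here refl) pi | no ¬py = ⊥-elim (¬py pi)
  source-onto (y ∷ ys) (there i∈)  pi | no _   = source-onto ys i∈ pi

allFin-sorted : ∀ n → AllPairs _≺_ (allFin n)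
allFin-sorted n = tabulate⁺-< id

module Part (X : List ℤ) {m : ℕ} (c : Fin (length X) → Fin m) (r : Fin m) where

  open Selection (λ i → c i ≟ r) (lookup X)

  position : Fin (length (part X c r)) → Fin (length X)
  position = source (allFin (length X))

  position-colour : ∀ q → c (position q) ≡ r
  position-colour = source-sat (allFin (length X))

  position-lookup : ∀ q → lookup (part X c r) q ≡ lookup X (position q)
  position-lookup = source-lookup (allFin (length X))

  position-mono : ∀ {q q′} → q ≺ q′ → position q ≺ position q′
  position-mono = source-mono (allFin (length X)) (allFin-sorted (length X)) _ _

  position-injective : ∀ {q q′} → position q ≡ position q′ → q ≡ q′
  position-injective {q} {q′} eq with <-cmp q q′
  ... | tri< q≺q′ _ _ = ⊥-elim (<-irrefl (cong toℕ eq) (position-mono q≺q′))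
  ... | tri≈ _ q≡q′ _ = q≡q′
  ... | tri> _ _ q′≺q = ⊥-elim (<-irrefl (cong toℕ (sym eq)) (position-mono q′≺q))

  position-onto : ∀ {i} → c i ≡ r → ∃ λ q → position q ≡ i
  position-onto {i} = source-onto (allFin (length X)) (∈-allFin i)

AscentStart : (X : List ℤ) → Fin (length X) → Set
AscentStart X a = ∃ λ b → a ≺ b × lookup X a ≤ℤ lookup X b

emptyOrSnoc : ∀ {k} (w : Word k) → w ≡ [] ⊎ ∃₂ λ u a → w ≡ u ∷ʳ a
emptyOrSnoc w with initLast w
... | []      = inj₁ refl
... | u ∷ʳ′ a = inj₂ (u , a , refl)

encode : ∀ {m B j} → Fin m ⊎ (Fin B × Fin j) → Fin (m + B * j)
encode {m} {B} {j} = join m (B * j) ∘ Sum.map₂ (uncurry combine)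

encode-injective : ∀ {m B j} → Injective _≡_ _≡_ (encode {m} {B} {j})
encode-injective {m} {B} {j} {d} {d′} eq =
  trans (sym (decode-encode d)) (trans (cong decode eq) (decode-encode d′))
  where
  decode : Fin (m + B * j) → Fin m ⊎ (Fin B × Fin j)
  decode = Sum.map₂ (remQuot j) ∘ splitAt m

  decode-encode : ∀ d → decode (encode d) ≡ d
  decode-encode (inj₁ r)       = cong (Sum.map₂ (remQuot j)) (splitAt-↑ˡ m r (B * j))
  decode-encode (inj₂ (t , a)) =
    trans (cong (Sum.map₂ (remQuot j)) (splitAt-↑ʳ m (B * j) (combine t a)))
          (cong inj₂ (remQuot-combine t a))

-- Given heaps on the parts of a colouring c, and a labelling g of
-- positions that is injective on ascent starts, every position is either
-- the root of its part or determined by (g of its parent, its last letter).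
module RootsAndChildren (X : List ℤ) {j m B : ℕ} (c : Fin (length X) → Fin m)
         (heap : ∀ r → KHeapable j (part X c r))
         (g : Fin (length X) → Fin B)
         (g-injective : ∀ {a a′} → AscentStart X a → AscentStart X a′ →
                        g a ≡ g a′ → a ≡ a′)
         where

  open Part X c

  tree : ∀ r → Fin (length (part X c r)) → Word j
  tree r = proj₁ (heap r)

  tree-injective : ∀ r → Injective _≡_ _≡_ (tree r)
  tree-injective r = proj₁ (proj₁ (proj₂ (heap r)))

  prefix-closed : ∀ r u v → InImage (tree r) (u ++ v) → InImage (tree r) u
  prefix-closed r = proj₁ (proj₂ (proj₁ (proj₂ (heap r))))

  -- In X, the parent of a node is earlier and not larger, so it starts an ascent.
  parent-ascent : ∀ r {q p a} → tree r q ≡ tree r p ∷ʳ a → AscentStart X (position r p)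
  parent-ascent r {q} {p} {a} q=pa with proj₂ (proj₂ (heap r)) q p a q=pa
  ... | p≺q , p≤q = position r q , position-mono r p≺q ,
                    subst₂ _≤ℤ_ (position-lookup r p) (position-lookup r q) p≤q

  Shape : Set
  Shape = Fin m ⊎ (Fin B × Fin j)

  -- The shape inj₁ r describes the root of part r; inj₂ (t , a) describes a
  -- child, along letter a, of a node whose position has label t.
  Describes : Fin (length X) → Shape → Set
  Describes i (inj₁ r) = ∃ λ q → position r q ≡ i × tree r q ≡ []
  Describes i (inj₂ (t , a)) =
    ∃ λ r → ∃₂ λ q p →
      position r q ≡ i × tree r q ≡ tree r p ∷ʳ a × g (position r p) ≡ t

  describe : ∀ i → ∃ (Describes i)
  describe i with position-onto (c i) refl
  ... | q , q↦i with emptyOrSnoc (tree (c i) q)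
  ... | inj₁ root = inj₁ (c i) , q , q↦i , root
  ... | inj₂ (u , a , q=ua) with prefix-closed (c i) u (a ∷ []) (q , q=ua)
  ... | p , p=u = inj₂ (g (position (c i) p) , a) ,
                  c i , q , p , q↦i , trans q=ua (cong (_∷ʳ a) (sym p=u)) , refl

  same-child : ∀ {r r′} → r ≡ r′ → ∀ {q p q′ p′ a} → position r p ≡ position r′ p′ →
               tree r q ≡ tree r p ∷ʳ a → tree r′ q′ ≡ tree r′ p′ ∷ʳ a →
               position r q ≡ position r′ q′
  same-child {r} refl p≡p′ q=pa q′=p′a with position-injective r p≡p′
  ... | refl = cong (position r) (tree-injective r (trans q=pa (sym q′=p′a)))

  describes-unique : ∀ {i i′} d → Describes i d → Describes i′ d → i ≡ i′
  describes-unique (inj₁ r) (q , refl , root) (q′ , refl , root′) =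
    cong (position r) (tree-injective r (trans root (sym root′)))
  describes-unique (inj₂ _) (r , q , p , refl , q=pa , refl)
                            (r′ , q′ , p′ , refl , q′=p′a , gp′) =
    same-child same-part same-parent q=pa q′=p′a
    where
    same-parent : position r p ≡ position r′ p′
    same-parent = g-injective (parent-ascent r q=pa) (parent-ascent r′ q′=p′a) (sym gp′)

    same-part : r ≡ r′
    same-part = trans (sym (position-colour r p))
                      (trans (cong c same-parent) (position-colour r′ p′))

  shape : Fin (length X) → Shape
  shape i = proj₁ (describe i)

  shape-injective : Injective _≡_ _≡_ shape
  shape-injective {i} {i′} eq =
    describes-unique (shape i′) (subst (Describes i) eq (proj₂ (describe i)))
                                (proj₂ (describe i′))

  bound : length X ≤ m + B * j
  bound = injective⇒≤ (shape-injective ∘ encode-injective)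

partitionLowerBound : ∀ (X : List ℤ) {j m B} (g : Fin (length X) → Fin B) →
  (∀ {a a′} → AscentStart X a → AscentStart X a′ → g a ≡ g a′ → a ≡ a′) →
  PartitionableInto j X m → length X ≤ m + B * j
partitionLowerBound X g g-injective (c , heap) = RootsAndChildren.bound X c heap g g-injective

-- A list of at most j+1 entries whose first entry is a minimum is
-- j-heapable: hang every other entry directly below the first.
module Star (j : ℕ) (y : ℤ) (ys : List ℤ) (short : length ys ≤ j) where

  tree : Fin (length (y ∷ ys)) → Word j
  tree zero    = []
  tree (suc q) = inject≤ q short ∷ []

  tree-injective : Injective _≡_ _≡_ tree
  tree-injective {zero}  {zero}  _  = refl
  tree-injective {suc q} {suc q′} eq =
    cong suc (inject≤-injective short short q q′ (∷-injectiveˡ eq))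
  tree-injective {zero}  {suc _} ()
  tree-injective {suc _} {zero}  ()

  prefix-closed : ∀ (u v : Word j) → InImage tree (u ++ v) → InImage tree u
  prefix-closed []          _       _         = zero , refl
  prefix-closed (a ∷ [])    []      (suc q , e) = suc q , e
  prefix-closed (a ∷ [])    (_ ∷ _) (suc q , ())
  prefix-closed (a ∷ _ ∷ _) _       (suc q , ())
  prefix-closed (a ∷ _)     _       (zero , ())

  -- The letters in use are exactly 0, …, |ys|-1, so smaller letters are in use.
  sibling-closed : ∀ (u : Word j) (a b : Fin j) → toℕ b < toℕ a →
                   InImage tree (u ++ (a ∷ [])) → InImage tree (u ++ (b ∷ []))
  sibling-closed [] a b b<a (suc q , refl) =
    suc (fromℕ< b<|ys|) , cong (_∷ [])
      (toℕ-injective (trans (toℕ-inject≤ (fromℕ< b<|ys|) short) (toℕ-fromℕ< b<|ys|)))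
    where
    b<|ys| : toℕ b < length ys
    b<|ys| = <-trans (<-≤-trans b<a (≤-reflexive (toℕ-inject≤ q short))) (toℕ<n q)
  sibling-closed [] a b b<a (zero , ())
  sibling-closed (_ ∷ [])    a b b<a (suc q , ())
  sibling-closed (_ ∷ _ ∷ _) a b b<a (suc q , ())
  sibling-closed (_ ∷ _)     a b b<a (zero , ())

  heap-ordered : (∀ q → y ≤ℤ lookup ys q) → ∀ (q p : Fin (length (y ∷ ys))) (a : Fin j) →
                 tree q ≡ tree p ++ (a ∷ []) →
                 (toℕ p < toℕ q) × (lookup (y ∷ ys) p ≤ℤ lookup (y ∷ ys) q)
  heap-ordered y≤ys (suc q) zero    a _  = s≤s z≤n , y≤ys q
  heap-ordered y≤ys zero    zero    a ()
  heap-ordered y≤ys zero    (suc _) a ()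
  heap-ordered y≤ys (suc q) (suc _) a ()

starHeapable : ∀ j (Y : List ℤ) → length Y ≤ suc j →
  (∀ p q → toℕ p ≡ 0 → lookup Y p ≤ℤ lookup Y q) → KHeapable j Y
starHeapable j [] _ _ =
  (λ ()) , ((λ {}) , (λ _ _ → λ { (() , _) }) , (λ _ _ _ _ → λ { (() , _) })) , λ ()
starHeapable j (y ∷ ys) (s≤s short) first-min =
  tree , (tree-injective , prefix-closed , sibling-closed) ,
  heap-ordered (λ q → first-min zero (suc q) refl)
  where open Star j y ys short

starPartition : ∀ (X : List ℤ) {j m} (c : Fin (length X) → Fin m)
  (slot : Fin (length X) → Fin (suc j)) →
  (∀ {i i′} → c i ≡ c i′ → slot i ≡ slot i′ → i ≡ i′) →
  (∀ {i i′} → c i ≡ c i′ → (∀ i″ → c i″ ≡ c i → toℕ i ≤ toℕ i″) →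
             lookup X i ≤ℤ lookup X i′) →
  PartitionableInto j X m
starPartition X {j} c slot slot-injective earliest-min =
  c , λ r → starHeapable j (part X c r) (size r) (first-min r)
  where
  open Part X c

  size : ∀ r → length (part X c r) ≤ suc j
  size r = injective⇒≤ λ {q} {q′} eq →
    position-injective r (slot-injective (trans (position-colour r q) (sym (position-colour r q′))) eq)

  first-earliest : ∀ r p → toℕ p ≡ 0 →
                   ∀ i″ → c i″ ≡ c (position r p) → toℕ (position r p) ≤ toℕ i″
  first-earliest r p p=0 i″ same with position-onto r (trans same (position-colour r p))
  ... | q , refl with <-cmp p q
  ... | tri< p≺q _ _ = <⇒≤ (position-mono r p≺q)
  ... | tri≈ _ refl _ = ≤-refl
  ... | tri> _ _ q≺p = ⊥-elim (n≮0 (subst (toℕ q <_) p=0 q≺p))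

  first-min : ∀ r p q → toℕ p ≡ 0 → lookup (part X c r) p ≤ℤ lookup (part X c r) q
  first-min r p q p=0 =
    subst₂ _≤ℤ_ (sym (position-lookup r p)) (sym (position-lookup r q))
      (earliest-min (trans (position-colour r p) (sym (position-colour r q)))
                    (first-earliest r p p=0))

-- Position x = (k+1)t + o  (block t < N, offset o ≤ k) carries the entry
-- -(x + k) if o = 0 and -x otherwise.
module BlockSequence (k N : ℕ) where

  bonus : Fin (suc k) → ℕ
  bonus zero    = k
  bonus (suc _) = 0

  weight : Fin (N * suc k) → ℕ
  weight x = toℕ x + bonus (proj₂ (remQuot {N} (suc k) x))

  X : List ℤ
  X = tabulate (λ x → - (+ weight x))

  length-X : length X ≡ N * suc k
  length-X = length-tabulate _

  index : Fin (length X) → Fin (N * suc k)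
  index = cast length-X

  block : Fin (length X) → Fin N
  block i = proj₁ (remQuot {N} (suc k) (index i))

  offset : Fin (length X) → Fin (suc k)
  offset i = proj₂ (remQuot {N} (suc k) (index i))

  w : Fin (length X) → ℕ
  w i = weight (index i)

  toℕ-index : ∀ i → toℕ (index i) ≡ toℕ i
  toℕ-index = toℕ-cast length-X

  coordinates : ∀ i → toℕ i ≡ suc k * toℕ (block i) + toℕ (offset i)
  coordinates i = begin
    toℕ i                                   ≡⟨ sym (toℕ-index i) ⟩
    toℕ (index i)                           ≡⟨ cong toℕ (sym (combine-remQuot {N} (suc k) (index i))) ⟩
    toℕ (combine (block i) (offset i))      ≡⟨ toℕ-combine (block i) (offset i) ⟩
    suc k * toℕ (block i) + toℕ (offset i)  ∎
    where open ≡-Reasoning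

  coordinates-injective : ∀ {i i′} → block i ≡ block i′ → offset i ≡ offset i′ → i ≡ i′
  coordinates-injective {i} {i′} bb oo = toℕ-injective (begin
    toℕ i                                    ≡⟨ coordinates i ⟩
    suc k * toℕ (block i) + toℕ (offset i)   ≡⟨ cong₂ (λ t o → suc k * toℕ t + toℕ o) bb oo ⟩
    suc k * toℕ (block i′) + toℕ (offset i′) ≡⟨ sym (coordinates i′) ⟩
    toℕ i′                                   ∎)
    where open ≡-Reasoning

  lookup-X : ∀ i → lookup X i ≡ - (+ w i)
  lookup-X i = trans (cong (lookup X) back-and-forth) (lookup-tabulate _ (index i))
    where
    back-and-forth : i ≡ cast (sym length-X) (index i)
    back-and-forth = toℕ-injective (sym (trans (toℕ-cast (sym length-X) (index i)) (toℕ-index i)))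

  ≤ℤ-from-w : ∀ {i i′} → w i′ ≤ w i → lookup X i ≤ℤ lookup X i′
  ≤ℤ-from-w {i} {i′} le =
    subst₂ _≤ℤ_ (sym (lookup-X i)) (sym (lookup-X i′)) (neg-mono-≤ (+≤+ le))

  w-from-≤ℤ : ∀ {i i′} → lookup X i ≤ℤ lookup X i′ → w i′ ≤ w i
  w-from-≤ℤ {i} {i′} le =
    drop‿+≤+ (neg-cancel-≤ (subst₂ _≤ℤ_ (lookup-X i) (lookup-X i′) le))

  w-base : ∀ {i} → offset i ≡ zero → w i ≡ toℕ i + k
  w-base {i} o=0 = cong₂ _+_ (toℕ-index i) (cong bonus o=0)

  w-nonbase : ∀ {i u} → offset i ≡ suc u → w i ≡ toℕ i
  w-nonbase {i} o=su = trans (cong₂ _+_ (toℕ-index i) (cong bonus o=su)) (+-identityʳ (toℕ i))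

  index≤w : ∀ i → toℕ i ≤ w i
  index≤w i = subst (_≤ w i) (toℕ-index i) (m≤m+n _ _)

  offset≤k : ∀ i → toℕ (offset i) ≤ k
  offset≤k i = s≤s⁻¹ (toℕ<n (offset i))

  base-least : ∀ {i i′} → offset i ≡ zero → block i ≡ block i′ → w i′ ≤ w i
  base-least {i} {i′} o=0 bb = by-offset (offset i′) refl
    where
    open ≤-Reasoning
    base-position : suc k * toℕ (block i) ≡ toℕ i
    base-position = sym (trans (coordinates i)
      (trans (cong (λ o → suc k * toℕ (block i) + toℕ o) o=0) (+-identityʳ _)))

    by-offset : ∀ o → offset i′ ≡ o → w i′ ≤ w i
    by-offset zero    o′=0  =
      ≤-reflexive (cong w (coordinates-injective (sym bb) (trans o′=0 (sym o=0))))
    by-offset (suc u) o′=su = begin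
      w i′                                     ≡⟨ w-nonbase o′=su ⟩
      toℕ i′                                   ≡⟨ coordinates i′ ⟩
      suc k * toℕ (block i′) + toℕ (offset i′) ≤⟨ +-monoʳ-≤ _ (offset≤k i′) ⟩
      suc k * toℕ (block i′) + k               ≡⟨ cong (λ t → suc k * toℕ t + k) (sym bb) ⟩
      suc k * toℕ (block i) + k                ≡⟨ cong (_+ k) base-position ⟩
      toℕ i + k                                ≡⟨ sym (w-base o=0) ⟩
      w i                                      ∎

  -- Only bases start ascents: every later entry is below a non-base entry.
  ascent-at-base : ∀ {a} → AscentStart X a → offset a ≡ zero
  ascent-at-base {a} (b , a≺b , a≤b) with offset a in o
  ... | zero  = refl
  ... | suc u = ⊥-elim (<⇒≱ (begin-strict
    w a    ≡⟨ w-nonbase o ⟩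
    toℕ a  <⟨ a≺b ⟩
    toℕ b  ≤⟨ index≤w b ⟩
    w b    ∎) (w-from-≤ℤ a≤b))
    where open ≤-Reasoning

  block-separates-ascents : ∀ {a a′} → AscentStart X a → AscentStart X a′ →
                            block a ≡ block a′ → a ≡ a′
  block-separates-ascents asc asc′ bb =
    coordinates-injective bb (trans (ascent-at-base asc) (sym (ascent-at-base asc′)))

  -- Lower bound: at most N positions start an ascent, so |X| ≤ m + N·j.
  lower : ∀ j → j ≤ suc k → ∀ m → PartitionableInto j X m → N * (suc k ∸ j) ≤ m
  lower j j≤k+1 m P = +-cancelʳ-≤ (N * j) (N * (suc k ∸ j)) m (begin
    N * (suc k ∸ j) + N * j  ≡⟨ sym (*-distribˡ-+ N (suc k ∸ j) j) ⟩
    N * (suc k ∸ j + j)      ≡⟨ cong (N *_) (m∸n+n≡m j≤k+1) ⟩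
    N * suc k                ≡⟨ sym length-X ⟩
    length X                 ≤⟨ partitionLowerBound X block block-separates-ascents P ⟩
    m + N * j                ∎)
    where open ≤-Reasoning

  base : Fin N → Fin (length X)
  base t = cast (sym length-X) (combine t zero)

  coordinates-base : ∀ t → remQuot {N} (suc k) (index (base t)) ≡ (t , zero)
  coordinates-base t = trans (cong (remQuot (suc k)) index-base) (remQuot-combine t zero)
    where
    index-base : index (base t) ≡ combine t zero
    index-base = toℕ-injective
      (trans (toℕ-index (base t)) (toℕ-cast (sym length-X) (combine t zero)))

  block-base : ∀ t → block (base t) ≡ t
  block-base t = cong proj₁ (coordinates-base t)

  offset-base : ∀ t → offset (base t) ≡ zero
  offset-base t = cong proj₂ (coordinates-base t)

  base-precedes : ∀ {i u} → offset i ≡ suc u → toℕ (base (block i)) < toℕ i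
  base-precedes {i} o=su = begin-strict
    toℕ (base t)                                    ≡⟨ coordinates (base t) ⟩
    suc k * toℕ (block (base t)) + toℕ (offset (base t))
      ≡⟨ cong₂ (λ t′ o → suc k * toℕ t′ + toℕ o) (block-base t) (offset-base t) ⟩
    suc k * toℕ t + 0                               <⟨ +-monoʳ-< _ 0<offset ⟩
    suc k * toℕ t + toℕ (offset i)                  ≡⟨ sym (coordinates i) ⟩
    toℕ i                                           ∎
    where
    open ≤-Reasoning
    t : Fin N
    t = block i

    0<offset : 0 < toℕ (offset i)
    0<offset = subst (λ o → 0 < toℕ o) (sym o=su) (s≤s z≤n)

  -- Upper bound for j ≤ k: colour position (t , o) by (t , o ∸ j).  The
  -- class (t , 0) holds offsets 0 … j and is a star rooted at the base;
  -- the other classes are singletons.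
  module Stars (j : ℕ) (j≤k : j ≤ k) where

    layer : Fin (suc k) → Fin (suc k ∸ j)
    layer o = fromℕ< (subst (toℕ o ∸ j <_) (sym (+-∸-assoc 1 j≤k)) (s≤s o∸j≤k∸j))
      where
      o∸j≤k∸j : toℕ o ∸ j ≤ k ∸ j
      o∸j≤k∸j = ∸-monoˡ-≤ j (s≤s⁻¹ (toℕ<n o))

    toℕ-layer : ∀ o → toℕ (layer o) ≡ toℕ o ∸ j
    toℕ-layer o = toℕ-fromℕ< _

    class : Fin (length X) → Fin (N * (suc k ∸ j))
    class i = combine (block i) (layer (offset i))

    class-block : ∀ {i i′} → class i ≡ class i′ → block i ≡ block i′
    class-block {i} {i′} =
      combine-injectiveˡ (block i) (layer (offset i)) (block i′) (layer (offset i′))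

    class-layer : ∀ {i i′} → class i ≡ class i′ → toℕ (offset i) ∸ j ≡ toℕ (offset i′) ∸ j
    class-layer {i} {i′} cc = begin
      toℕ (offset i) ∸ j       ≡⟨ sym (toℕ-layer (offset i)) ⟩
      toℕ (layer (offset i))   ≡⟨ cong toℕ (combine-injectiveʳ (block i) (layer (offset i))
                                                               (block i′) (layer (offset i′)) cc) ⟩
      toℕ (layer (offset i′))  ≡⟨ toℕ-layer (offset i′) ⟩
      toℕ (offset i′) ∸ j      ∎
      where open ≡-Reasoning

    slot : Fin (length X) → Fin (suc j)
    slot i = fromℕ< (s≤s (m⊓n≤m j (toℕ (offset i))))

    -- Within a class, an offset is recovered from  j ⊓ o  and  o ∸ j.
    slot-injective : ∀ {i i′} → class i ≡ class i′ → slot i ≡ slot i′ → i ≡ i′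
    slot-injective {i} {i′} cc ss = coordinates-injective (class-block cc) (toℕ-injective (begin
      toℕ (offset i)                              ≡⟨ sym (m⊓n+n∸m≡n j _) ⟩
      j ⊓ toℕ (offset i) + (toℕ (offset i) ∸ j)   ≡⟨ cong₂ _+_ same-slot (class-layer cc) ⟩
      j ⊓ toℕ (offset i′) + (toℕ (offset i′) ∸ j) ≡⟨ m⊓n+n∸m≡n j _ ⟩
      toℕ (offset i′)                             ∎))
      where
      open ≡-Reasoning
      same-slot : j ⊓ toℕ (offset i) ≡ j ⊓ toℕ (offset i′)
      same-slot = trans (sym (toℕ-fromℕ< _)) (trans (cong toℕ ss) (toℕ-fromℕ< _))

    lower-layer-has-base : ∀ {i} → toℕ (offset i) ≤ j → class (base (block i)) ≡ class i
    lower-layer-has-base {i} o≤j = cong₂ combine (block-base (block i)) (toℕ-injective (begin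
      toℕ (layer (offset (base (block i))))   ≡⟨ cong (toℕ ∘ layer) (offset-base (block i)) ⟩
      toℕ (layer zero)                        ≡⟨ toℕ-layer zero ⟩
      0 ∸ j                                   ≡⟨ 0∸n≡0 j ⟩
      0                                       ≡⟨ sym (m≤n⇒m∸n≡0 o≤j) ⟩
      toℕ (offset i) ∸ j                      ≡⟨ sym (toℕ-layer (offset i)) ⟩
      toℕ (layer (offset i))                  ∎))
      where open ≡-Reasoning

    upper-layer-singleton : ∀ {i i′} → j < toℕ (offset i) → class i ≡ class i′ → i ≡ i′
    upper-layer-singleton {i} {i′} j<o cc =
      coordinates-injective (class-block cc) (toℕ-injective (begin
        toℕ (offset i)           ≡⟨ sym (m∸n+n≡m (<⇒≤ j<o)) ⟩
        toℕ (offset i) ∸ j + j   ≡⟨ cong (_+ j) (class-layer cc) ⟩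
        toℕ (offset i′) ∸ j + j  ≡⟨ m∸n+n≡m j≤o′ ⟩
        toℕ (offset i′)          ∎))
      where
      open ≡-Reasoning
      j≤o′ : j ≤ toℕ (offset i′)
      j≤o′ = ≮⇒≥ λ o′<j → <-irrefl refl
        (subst (0 <_) (trans (class-layer cc) (m≤n⇒m∸n≡0 (<⇒≤ o′<j))) (m<n⇒0<n∸m j<o))

    -- The earliest member of a class is its base or its only member.
    earliest-min : ∀ {i i′} → class i ≡ class i′ →
                   (∀ i″ → class i″ ≡ class i → toℕ i ≤ toℕ i″) → lookup X i ≤ℤ lookup X i′
    earliest-min {i} {i′} cc earliest = ≤ℤ-from-w (by-offset (offset i) refl)
      where
      by-offset : ∀ o → offset i ≡ o → w i′ ≤ w i
      by-offset zero    o=0  = base-least o=0 (class-block cc)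
      by-offset (suc u) o=su with toℕ (offset i) ≤? j
      ... | yes o≤j = ⊥-elim (<⇒≱ (base-precedes o=su)
                                  (earliest (base (block i)) (lower-layer-has-base o≤j)))
      ... | no  o≰j = ≤-reflexive (cong w (sym (upper-layer-singleton (≰⇒> o≰j) cc)))

    upper : PartitionableInto j X (N * (suc k ∸ j))
    upper = starPartition X class slot slot-injective earliest-min

  mhs : ∀ j → j ≤ k → IsMHS j X (N * (suc k ∸ j))
  mhs j j≤k = Stars.upper j j≤k , lower j (m≤n⇒m≤1+n j≤k)

complement-decreasing : ∀ {j k} → j < k → suc k ∸ suc j < suc k ∸ j
complement-decreasing {j} j<k = ∸-monoʳ-< (s≤s ≤-refl) (m≤n⇒m≤1+n j<k)

theorem2 : (k : ℕ) → 2 ≤ k →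
    (∃ λ (X : List ℤ) → ∃ λ (f : ℕ → ℕ) →
        (∀ j → 1 ≤ j → j ≤ k → IsMHS j X (f j))
        × (∀ j → 1 ≤ j → j < k → f (suc j) < f j))
    × (∀ (N : ℕ) → ∃ λ (X : List ℤ) → ∃ λ (a : ℕ) → ∃ λ (b : ℕ) →
        IsMHS (k ∸ 1) X a × IsMHS k X b × N + b ≤ a)
theorem2 k@(suc (suc k′)) (s≤s (s≤s z≤n)) =
  -- (a) one block: MHS_j = k+1-j for 1 ≤ j ≤ k.
  (X 1 , (λ j → 1 * (suc k ∸ j)) ,
   (λ j _ j≤k → mhs 1 j j≤k) ,
   (λ j _ j<k → *-monoʳ-< 1 (complement-decreasing j<k))) ,
  -- (b) N blocks: MHS_{k-1} = 2N and MHS_k = N.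
  λ N → X N , N * (suc k ∸ (k ∸ 1)) , N * (suc k ∸ k) ,
        mhs N (k ∸ 1) (m∸n≤m k 1) , mhs N k ≤-refl , ≤-reflexive (gap N)
  where
  open BlockSequence k

  gap : ∀ N → N + N * (suc k ∸ k) ≡ N * (suc k ∸ (k ∸ 1))
  gap N = begin
    N + N * (suc k ∸ k)       ≡⟨ cong (λ d → N + N * d) (m+n∸n≡m 1 k) ⟩
    N + N * 1                 ≡⟨ sym (*-suc N 1) ⟩
    N * 2                     ≡⟨ cong (N *_) (sym (m+n∸n≡m 2 k′)) ⟩
    N * (suc k ∸ (k ∸ 1))     ∎
    where open ≡-Reasoning
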